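{- Let $V(0)=\begin{pmatrix}S_F(0)\\ S_F(0)\end{pmatrix}=\begin{pmatrix}1\\1\end{pmatrix}$ and let $\mu:\{0,01\}^*\to\mathbb{Z}^{2\times 2}$ be the monoid morphism defined by $$\mu(0)=\begin{pmatrix}0&1\\-1&2\end{pmatrix},\qquad \mu(01)=\begin{pmatrix}2&0\\3&0\end{pmatrix}.$$ For all $n\ge 0$, write $0\,\mathrm{rep}_F(n)=u_k\cdots u_1$ with $u_i\in\{0,01\}$ for all $i\in\{1,\ldots,k\}$. Then $$S_F(n)=\begin{pmatrix}1&0\end{pmatrix}\mu(u_1)\cdots\mu(u_k)\,V(0).$$
   Context: Let $(F(n))_{n\ge 0}$ be defined by $F(0)=1$, $F(1)=2$, $F(n+2)=F(n+1)+F(n)$. For $n\ge 1$, $\mathrm{rep}_F(n)$ is the greedy (Zeckendorf) representation of $n$: the word $c_{\ell-1}\cdots c_0$ over $\{0,1\}$ with $c_{\ell-1}=1$, no factor $11$, and $n=\sum_j c_jF(j)$; $\mathrm{rep}_F(0)=\varepsilon$. Let $L_F=\{\varepsilon\}\cup 1\{0,01\}^*$. For words $u,v$, $\binom{u}{v}$ is the number of occurrences of $v$ as a scattered subword (subsequence) of $u$, and $S_F(n)=\#\{v\in L_F : \binom{\mathrm{rep}_F(n)}{v}>0\}$. -}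

module Defs where

open import Data.Nat using (ℕ; zero; suc; _+_; _∸_; _≤?_)
open import Data.Integer as ℤ using (ℤ; +_; -_)
open import Data.Bool using (Bool; true; false; _∧_; if_then_else_)
open import Data.List using (List; []; _∷_; _++_; map; concatMap; length; filter; foldr; upTo)
open import Relation.Nullary using (yes; no)
open import Relation.Nullary.Decidable using (⌊_⌋)
open import Relation.Binary.PropositionalEquality using (_≡_)

F : ℕ → ℕ
F zero = 1
F (suc zero) = 2
F (suc (suc n)) = F (suc n) + F n

data Bit : Set where
  b0 b1 : Bit

Word : Set
Word = List Bit

_==ᵇ_ : Bit → Bit → Bool
b0 ==ᵇ b0 = true
b1 ==ᵇ b1 = true
_  ==ᵇ _  = false

greedy : ℕ → ℕ → Word
greedy zero r = []
greedy (suc j) r with F j ≤? r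
... | yes _ = b1 ∷ greedy j (r ∸ F j)
... | no  _ = b0 ∷ greedy j r

dropLeading0 : Word → Word
dropLeading0 [] = []
dropLeading0 (b0 ∷ w) = dropLeading0 w
dropLeading0 (b1 ∷ w) = b1 ∷ w

-- rep_F n : greedy (Zeckendorf) representation, most significant digit first,
-- no leading zeros; rep_F 0 = ε.  Since F j > n for j ≥ n, positions ≥ n+1 are 0.
repF : ℕ → Word
repF n = dropLeading0 (greedy (suc n) n)

binom : Word → Word → ℕ
binom u [] = 1
binom [] (_ ∷ _) = 0
binom (a ∷ u) (b ∷ v) = (if a ==ᵇ b then binom u v else 0) + binom u (b ∷ v)

inBlocks : Word → Bool
inBlocks [] = true
inBlocks (b0 ∷ b1 ∷ w) = inBlocks w
inBlocks (b0 ∷ w) = inBlocks w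
inBlocks (b1 ∷ w) = false

inLF : Word → Bool
inLF [] = true
inLF (b0 ∷ _) = false
inLF (b1 ∷ w) = inBlocks w

wordsOfLength : ℕ → List Word
wordsOfLength zero = [] ∷ []
wordsOfLength (suc k) = concatMap (λ w → (b0 ∷ w) ∷ (b1 ∷ w) ∷ []) (wordsOfLength k)

wordsUpTo : ℕ → List Word
wordsUpTo k = concatMap wordsOfLength (upTo (suc k))

positive : ℕ → Bool
positive zero = false
positive (suc _) = true

-- Any v with binom u v > 0 has length ≤ length u, so it suffices to count over
-- the (duplicate-free) list of all words of length ≤ length (rep_F n).
SF : ℕ → ℕ
SF n = length (filter (λ v → Data.Bool.T? (inLF v ∧ positive (binom (repF n) v)))
                      (wordsUpTo (length (repF n))))
  where import Data.Bool

data Block : Set where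
  z zo : Block

blockWord : Block → Word
blockWord z  = b0 ∷ []
blockWord zo = b0 ∷ b1 ∷ []

record Mat2 : Set where
  constructor mat
  field
    a b c d : ℤ

_⊗_ : Mat2 → Mat2 → Mat2
mat a b c d ⊗ mat a' b' c' d' =
  mat (a ℤ.* a' ℤ.+ b ℤ.* c') (a ℤ.* b' ℤ.+ b ℤ.* d')
      (c ℤ.* a' ℤ.+ d ℤ.* c') (c ℤ.* b' ℤ.+ d ℤ.* d')

I₂ : Mat2
I₂ = mat (+ 1) (+ 0) (+ 0) (+ 1)

μ : Block → Mat2
μ z  = mat (+ 0) (+ 1) (- (+ 1)) (+ 2)
μ zo = mat (+ 2) (+ 0) (+ 3) (+ 0)

μ* : List Block → Mat2
μ* = foldr (λ u M → μ u ⊗ M) I₂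

rowVec : ℤ → ℤ → Mat2 → ℤ → ℤ → ℤ
rowVec r₁ r₂ (mat a b c d) v₁ v₂ =
  r₁ ℤ.* (a ℤ.* v₁ ℤ.+ b ℤ.* v₂) ℤ.+ r₂ ℤ.* (c ℤ.* v₁ ℤ.+ d ℤ.* v₂)

V0₁ V0₂ : ℤ
V0₁ = + SF 0
V0₂ = + SF 0

-- A word occurs in u as a scattered subword iff the greedy left-to-right matching succeeds, so
-- S_F(n) counts the words of L_F that are subsequences of t = 0 rep_F(n).  Together with the
-- numbers of subsequences of t lying in {0,01}* and of those v with 0v ∈ {0,01}*, this count
-- obeys a linear recurrence when a letter is prepended to t: match the first letter of v
-- against it or skip it.  Shifted by 0, 1 and 2, the three counts of u_k⋯u_1 are the values of
-- the row (1 0) μ(u_1)⋯μ(u_k) on the columns (1,1), (2,3) and (3,4), because μ(0) and μ(01)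
-- act on these three columns exactly as prepending the blocks 0 and 01 acts on the counts.
module Submission where

open import Defs
open import Data.Nat using (ℕ)
open import Data.Integer using (ℤ; +_)
open import Data.List using (List; concatMap; reverse; _∷_)
open import Relation.Binary.PropositionalEquality using (_≡_)

open import Algebra.Properties.CommutativeSemigroup using (interchange)
open import Data.Bool using (Bool; true; false; _∧_; _∨_; if_then_else_; T?)
open import Data.Bool.Properties using (∧-zeroʳ)
open import Data.Integer as ℤ using ()
open import Data.Integer.Properties using (pos-+)
open import Data.Integer.Tactic.RingSolver using (solve-∀)
open import Data.List using ([]; _++_; filter; length; applyUpTo; [_])
open import Data.List.Properties using (unfold-reverse)
open import Data.Nat using (zero; suc; _+_; _≤_; s≤s)
open import Data.Nat.Properties
  using (+-assoc; +-identityʳ; +-suc; +-commutativeSemigroup; ≤-refl; m≤n⇒m≤1+n)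
import Data.Nat.Tactic.RingSolver as ℕ-Solver
open import Data.Product using (_×_; _,_; proj₁)
open import Function using (_∘_)
open import Relation.Binary.PropositionalEquality using (refl; sym; trans; cong; cong₂; module ≡-Reasoning)

indicator : Bool → ℕ
indicator true  = 1
indicator false = 0

count : (Word → Bool) → List Word → ℕ
count P []       = 0
count P (w ∷ ws) = indicator (P w) + count P ws

length-filter-T? : ∀ P ws → length (filter (λ v → T? (P v)) ws) ≡ count P ws
length-filter-T? P [] = refl
length-filter-T? P (w ∷ ws) with P w
... | true  = cong suc (length-filter-T? P ws)
... | false = length-filter-T? P ws

count-++ : ∀ P ws vs → count P (ws ++ vs) ≡ count P ws + count P vs
count-++ P []       vs = refl
count-++ P (w ∷ ws) vs =
  trans (cong (_+_ (indicator (P w))) (count-++ P ws vs)) (sym (+-assoc (indicator (P w)) _ _))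

count-cong : ∀ {P Q} → (∀ v → P v ≡ Q v) → ∀ ws → count P ws ≡ count Q ws
count-cong P≗Q []       = refl
count-cong P≗Q (w ∷ ws) = cong₂ _+_ (cong indicator (P≗Q w)) (count-cong P≗Q ws)

count-false : ∀ {P} → (∀ v → P v ≡ false) → ∀ ws → count P ws ≡ 0
count-false P≗false []       = refl
count-false P≗false (w ∷ ws) rewrite P≗false w = count-false P≗false ws

count-prependBits : ∀ P ws →
  count P (concatMap (λ w → (b0 ∷ w) ∷ (b1 ∷ w) ∷ []) ws)
    ≡ count (P ∘ (b0 ∷_)) ws + count (P ∘ (b1 ∷_)) ws
count-prependBits P []       = refl
count-prependBits P (w ∷ ws) = begin
  x + (y + count P (concatMap _ ws))
    ≡⟨ cong (λ k → x + (y + k)) (count-prependBits P ws) ⟩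
  x + (y + (count (P ∘ (b0 ∷_)) ws + count (P ∘ (b1 ∷_)) ws))
    ≡⟨ sym (+-assoc x y _) ⟩
  (x + y) + (count (P ∘ (b0 ∷_)) ws + count (P ∘ (b1 ∷_)) ws)
    ≡⟨ interchange +-commutativeSemigroup x y _ _ ⟩
  (x + count (P ∘ (b0 ∷_)) ws) + (y + count (P ∘ (b1 ∷_)) ws) ∎
  where
  open ≡-Reasoning
  x y : ℕ
  x = indicator (P (b0 ∷ w))
  y = indicator (P (b1 ∷ w))

count-longerWords : ∀ P f n →
  count P (concatMap wordsOfLength (applyUpTo (suc ∘ f) n))
    ≡ count (P ∘ (b0 ∷_)) (concatMap wordsOfLength (applyUpTo f n))
      + count (P ∘ (b1 ∷_)) (concatMap wordsOfLength (applyUpTo f n))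
count-longerWords P f zero    = refl
count-longerWords P f (suc n) = begin
  count P (wordsOfLength (suc (f 0)) ++ rest (suc ∘ f))
    ≡⟨ count-++ P (wordsOfLength (suc (f 0))) _ ⟩
  count P (wordsOfLength (suc (f 0))) + count P (rest (suc ∘ f))
    ≡⟨ cong₂ _+_ (count-prependBits P w₀) (count-longerWords P (f ∘ suc) n) ⟩
  (count P₀ w₀ + count P₁ w₀) + (count P₀ (rest f) + count P₁ (rest f))
    ≡⟨ interchange +-commutativeSemigroup (count P₀ w₀) (count P₁ w₀) (count P₀ (rest f)) _ ⟩
  (count P₀ w₀ + count P₀ (rest f)) + (count P₁ w₀ + count P₁ (rest f))
    ≡⟨ sym (cong₂ _+_ (count-++ P₀ w₀ (rest f)) (count-++ P₁ w₀ (rest f))) ⟩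
  count P₀ (w₀ ++ rest f) + count P₁ (w₀ ++ rest f) ∎
  where
  open ≡-Reasoning
  P₀ P₁ : Word → Bool
  P₀ = P ∘ (b0 ∷_)
  P₁ = P ∘ (b1 ∷_)
  w₀ : List Word
  w₀ = wordsOfLength (f 0)
  rest : (ℕ → ℕ) → List Word
  rest g = concatMap wordsOfLength (applyUpTo (g ∘ suc) n)

countUpTo : ℕ → (Word → Bool) → ℕ
countUpTo L P = count P (wordsUpTo L)

countUpTo-suc : ∀ L P →
  countUpTo (suc L) P ≡ indicator (P []) + (countUpTo L (P ∘ (b0 ∷_)) + countUpTo L (P ∘ (b1 ∷_)))
countUpTo-suc L P = cong (_+_ (indicator (P []))) (count-longerWords P (λ k → k) (suc L))

countUpTo-onlyEmpty : ∀ P L → P [] ≡ true → (∀ b v → P (b ∷ v) ≡ false) → countUpTo L P ≡ 1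
countUpTo-onlyEmpty P zero    P[] _ rewrite P[] = refl
countUpTo-onlyEmpty P (suc L) P[] P∷ =
  trans (countUpTo-suc L P)
        (cong₂ _+_ (cong indicator P[])
                   (cong₂ _+_ (count-false (P∷ b0) (wordsUpTo L)) (count-false (P∷ b1) (wordsUpTo L))))

isSubword : Word → Word → Bool
isSubword []      u       = true
isSubword (c ∷ v) []      = false
isSubword (c ∷ v) (a ∷ u) = if c ==ᵇ a then isSubword v u else isSubword (c ∷ v) u

mutual
  isSubword-tail : ∀ c v u → isSubword (c ∷ v) u ≡ true → isSubword v u ≡ true
  isSubword-tail c  v []       ()
  isSubword-tail b0 v (b0 ∷ u) cv⊑u = isSubword-cons v u b0 cv⊑u
  isSubword-tail b1 v (b1 ∷ u) cv⊑u = isSubword-cons v u b1 cv⊑u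
  isSubword-tail b0 v (b1 ∷ u) cv⊑u = isSubword-cons v u b1 (isSubword-tail b0 v u cv⊑u)
  isSubword-tail b1 v (b0 ∷ u) cv⊑u = isSubword-cons v u b0 (isSubword-tail b1 v u cv⊑u)

  isSubword-cons : ∀ v u a → isSubword v u ≡ true → isSubword v (a ∷ u) ≡ true
  isSubword-cons []       u a  _    = refl
  isSubword-cons (b0 ∷ v) u b0 v⊑u = isSubword-tail b0 v u v⊑u
  isSubword-cons (b1 ∷ v) u b1 v⊑u = isSubword-tail b1 v u v⊑u
  isSubword-cons (b0 ∷ v) u b1 v⊑u = v⊑u
  isSubword-cons (b1 ∷ v) u b0 v⊑u = v⊑u

positive-+ : ∀ m n → positive (m + n) ≡ positive m ∨ positive n
positive-+ zero    n = refl
positive-+ (suc m) n = refl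

∨-absorbs-implied : ∀ x y → (y ≡ true → x ≡ true) → x ∨ y ≡ x
∨-absorbs-implied true  y     _   = refl
∨-absorbs-implied false true  y⇒x = sym (y⇒x refl)
∨-absorbs-implied false false _   = refl

positive-binom-head : ∀ c u v → positive (binom u v + binom u (c ∷ v)) ≡ isSubword v u

positive-binom : ∀ u v → positive (binom u v) ≡ isSubword v u
positive-binom u        []       = refl
positive-binom []       (c ∷ v)  = refl
positive-binom (b0 ∷ u) (b0 ∷ v) = positive-binom-head b0 u v
positive-binom (b1 ∷ u) (b1 ∷ v) = positive-binom-head b1 u v
positive-binom (b0 ∷ u) (b1 ∷ v) = positive-binom u (b1 ∷ v)
positive-binom (b1 ∷ u) (b0 ∷ v) = positive-binom u (b0 ∷ v)

positive-binom-head c u v = begin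
  positive (binom u v + binom u (c ∷ v))
    ≡⟨ positive-+ (binom u v) _ ⟩
  positive (binom u v) ∨ positive (binom u (c ∷ v))
    ≡⟨ cong₂ _∨_ (positive-binom u v) (positive-binom u (c ∷ v)) ⟩
  isSubword v u ∨ isSubword (c ∷ v) u
    ≡⟨ ∨-absorbs-implied _ _ (isSubword-tail c v u) ⟩
  isSubword v u ∎
  where open ≡-Reasoning

lfSubword blocksSubword blocks₀Subword : Word → Word → Bool
lfSubword      t v = inLF v ∧ isSubword v t
blocksSubword  t v = inBlocks v ∧ isSubword v t
blocks₀Subword t v = inBlocks (b0 ∷ v) ∧ isSubword v t

record SubwordCounts : Set where
  constructor counts
  field
    lf blocks blocks₀ : ℕ
open SubwordCounts

subwordCounts : Word → SubwordCounts
subwordCounts []       = counts 1 1 1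
subwordCounts (b0 ∷ t) = counts (lf c) (suc (blocks₀ c)) (blocks₀ c + lf c)
  where
  c : SubwordCounts
  c = subwordCounts t
subwordCounts (b1 ∷ t) = counts (suc (blocks c)) (blocks c) (blocks c + blocks c)
  where
  c : SubwordCounts
  c = subwordCounts t

record Counted (L : ℕ) (t : Word) : Set where
  field
    lf-count      : countUpTo L (lfSubword t)      ≡ lf      (subwordCounts t)
    blocks-count  : countUpTo L (blocksSubword t)  ≡ blocks  (subwordCounts t)
    blocks₀-count : countUpTo L (blocks₀Subword t) ≡ blocks₀ (subwordCounts t)
open Counted

counted-[] : ∀ L → Counted L []
counted-[] L = record
  { lf-count      = countUpTo-onlyEmpty (lfSubword []) L refl (λ b v → ∧-zeroʳ (inLF (b ∷ v)))
  ; blocks-count  = countUpTo-onlyEmpty (blocksSubword []) L refl (λ b v → ∧-zeroʳ (inBlocks (b ∷ v)))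
  ; blocks₀-count = countUpTo-onlyEmpty (blocks₀Subword []) L refl (λ b v → ∧-zeroʳ (inBlocks (b0 ∷ b ∷ v)))
  }

counted-b0 : ∀ {L t} → Counted L t → Counted (suc L) t → Counted (suc L) (b0 ∷ t)
counted-b0 {L} {t} ih ih′ = record
  { lf-count      = trans (count-cong same-lf (wordsUpTo (suc L))) (lf-count ih′)
  ; blocks-count  = begin
      countUpTo (suc L) (blocksSubword (b0 ∷ t))
        ≡⟨ countUpTo-suc L (blocksSubword (b0 ∷ t)) ⟩
      suc (countUpTo L (blocks₀Subword t) + countUpTo L (λ _ → false))
        ≡⟨ cong₂ (λ m n → suc (m + n)) (blocks₀-count ih) (count-false (λ _ → refl) (wordsUpTo L)) ⟩
      suc (blocks₀ (subwordCounts t) + 0)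
        ≡⟨ cong suc (+-identityʳ _) ⟩
      suc (blocks₀ (subwordCounts t)) ∎
  ; blocks₀-count = begin
      countUpTo (suc L) (blocks₀Subword (b0 ∷ t))
        ≡⟨ countUpTo-suc L (blocks₀Subword (b0 ∷ t)) ⟩
      suc (countUpTo L (blocks₀Subword t) + W)
        ≡⟨ sym (+-suc _ W) ⟩
      countUpTo L (blocks₀Subword t) + suc W
        ≡⟨ cong₂ _+_ (blocks₀-count ih) (trans (sym lf-split) (lf-count ih′)) ⟩
      blocks₀ (subwordCounts t) + lf (subwordCounts t) ∎
  }
  where
  open ≡-Reasoning
  same-lf : ∀ v → lfSubword (b0 ∷ t) v ≡ lfSubword t v
  same-lf []       = refl
  same-lf (b0 ∷ v) = refl
  same-lf (b1 ∷ v) = refl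
  W : ℕ
  W = countUpTo L (λ v → inBlocks v ∧ isSubword (b1 ∷ v) t)
  lf-split : countUpTo (suc L) (lfSubword t) ≡ suc W
  lf-split = trans (countUpTo-suc L (lfSubword t))
                   (cong (λ k → suc (k + W)) (count-false (λ _ → refl) (wordsUpTo L)))

counted-b1 : ∀ {L t} → Counted L t → Counted (suc L) t → Counted (suc L) (b1 ∷ t)
counted-b1 {L} {t} ih ih′ = record
  { lf-count      = trans (countUpTo-suc L (lfSubword (b1 ∷ t)))
      (cong suc (cong₂ _+_ (count-false (λ _ → refl) (wordsUpTo L)) (blocks-count ih)))
  ; blocks-count  = trans (count-cong same-blocks (wordsUpTo (suc L))) (blocks-count ih′)
  ; blocks₀-count = begin
      countUpTo (suc L) (blocks₀Subword (b1 ∷ t))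
        ≡⟨ countUpTo-suc L (blocks₀Subword (b1 ∷ t)) ⟩
      suc (A + countUpTo L (blocksSubword t))
        ≡⟨ cong (λ k → suc (A + k)) (blocks-count ih) ⟩
      suc A + blocks (subwordCounts t)
        ≡⟨ cong (_+ blocks (subwordCounts t)) (trans (sym blocks-split) (blocks-count ih′)) ⟩
      blocks (subwordCounts t) + blocks (subwordCounts t) ∎
  }
  where
  open ≡-Reasoning
  same-blocks : ∀ v → blocksSubword (b1 ∷ t) v ≡ blocksSubword t v
  same-blocks []       = refl
  same-blocks (b0 ∷ v) = refl
  same-blocks (b1 ∷ v) = refl
  A : ℕ
  A = countUpTo L (λ v → inBlocks (b0 ∷ v) ∧ isSubword (b0 ∷ v) t)
  blocks-split : countUpTo (suc L) (blocksSubword t) ≡ suc A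
  blocks-split = begin
    countUpTo (suc L) (blocksSubword t)
      ≡⟨ countUpTo-suc L (blocksSubword t) ⟩
    suc (A + countUpTo L (λ _ → false))
      ≡⟨ cong (λ k → suc (A + k)) (count-false (λ _ → refl) (wordsUpTo L)) ⟩
    suc (A + 0)
      ≡⟨ cong suc (+-identityʳ A) ⟩
    suc A ∎

-- Quantifying over every bound L ≥ |t| (not just L = |t|) makes the induction go through,
-- since prepending a letter raises the bound needed for t by one.
counted : ∀ t L → length t ≤ L → Counted L t
counted []       L       _          = counted-[] L
counted (b0 ∷ t) (suc L) (s≤s t≤L) = counted-b0 (counted t L t≤L) (counted t (suc L) (m≤n⇒m≤1+n t≤L))
counted (b1 ∷ t) (suc L) (s≤s t≤L) = counted-b1 (counted t L t≤L) (counted t (suc L) (m≤n⇒m≤1+n t≤L))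

SF≡lf : ∀ n → SF n ≡ lf (subwordCounts (repF n))
SF≡lf n = begin
  SF n
    ≡⟨ length-filter-T? P (wordsUpTo L) ⟩
  count P (wordsUpTo L)
    ≡⟨ count-cong (λ v → cong (inLF v ∧_) (positive-binom (repF n) v)) (wordsUpTo L) ⟩
  countUpTo L (lfSubword (repF n))
    ≡⟨ lf-count (counted (repF n) L ≤-refl) ⟩
  lf (subwordCounts (repF n)) ∎
  where
  open ≡-Reasoning
  L : ℕ
  L = length (repF n)
  P : Word → Bool
  P = λ v → inLF v ∧ positive (binom (repF n) v)

Col : Set
Col = ℤ × ℤ

infixr 7 _·_
infixl 6 _+ᶜ_

_·_ : Mat2 → Col → Col
mat a b c d · (x , y) = (a ℤ.* x ℤ.+ b ℤ.* y , c ℤ.* x ℤ.+ d ℤ.* y)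

_+ᶜ_ : Col → Col → Col
(x , y) +ᶜ (x′ , y′) = (x ℤ.+ x′ , y ℤ.+ y′)

·-⊗ : ∀ M N v → (M ⊗ N) · v ≡ M · (N · v)
·-⊗ (mat a b c d) (mat a′ b′ c′ d′) (x , y) =
  cong₂ _,_ (row a b a′ b′ c′ d′ x y) (row c d a′ b′ c′ d′ x y)
  where
  row : ∀ p q a′ b′ c′ d′ x y → (p ℤ.* a′ ℤ.+ q ℤ.* c′) ℤ.* x ℤ.+ (p ℤ.* b′ ℤ.+ q ℤ.* d′) ℤ.* y
              ≡ p ℤ.* (a′ ℤ.* x ℤ.+ b′ ℤ.* y) ℤ.+ q ℤ.* (c′ ℤ.* x ℤ.+ d′ ℤ.* y)
  row = solve-∀

·-I₂ : ∀ v → I₂ · v ≡ v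
·-I₂ (x , y) = cong₂ _,_ (first x y) (second x y)
  where
  first : ∀ x y → + 1 ℤ.* x ℤ.+ + 0 ℤ.* y ≡ x
  first = solve-∀
  second : ∀ x y → + 0 ℤ.* x ℤ.+ + 1 ℤ.* y ≡ y
  second = solve-∀

·-+ᶜ : ∀ M v w → M · (v +ᶜ w) ≡ M · v +ᶜ M · w
·-+ᶜ (mat a b c d) (x , y) (x′ , y′) =
  cong₂ _,_ (row a b x y x′ y′) (row c d x y x′ y′)
  where
  row : ∀ p q x y x′ y′ → p ℤ.* (x ℤ.+ x′) ℤ.+ q ℤ.* (y ℤ.+ y′)
              ≡ (p ℤ.* x ℤ.+ q ℤ.* y) ℤ.+ (p ℤ.* x′ ℤ.+ q ℤ.* y′)
  row = solve-∀

μ*-++-· : ∀ xs ys v → μ* (xs ++ ys) · v ≡ μ* xs · (μ* ys · v)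
μ*-++-· []       ys v = sym (·-I₂ (μ* ys · v))
μ*-++-· (x ∷ xs) ys v = begin
  (μ x ⊗ μ* (xs ++ ys)) · v   ≡⟨ ·-⊗ (μ x) _ v ⟩
  μ x · (μ* (xs ++ ys) · v)   ≡⟨ cong (μ x ·_) (μ*-++-· xs ys v) ⟩
  μ x · (μ* xs · (μ* ys · v)) ≡⟨ sym (·-⊗ (μ x) (μ* xs) _) ⟩
  (μ x ⊗ μ* xs) · (μ* ys · v) ∎
  where open ≡-Reasoning

μ*-reverse-∷-· : ∀ u us v → μ* (reverse (u ∷ us)) · v ≡ μ* (reverse us) · (μ u · v)
μ*-reverse-∷-· u us v = begin
  μ* (reverse (u ∷ us)) · v               ≡⟨ cong (λ xs → μ* xs · v) (unfold-reverse u us) ⟩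
  μ* (reverse us ++ [ u ]) · v            ≡⟨ μ*-++-· (reverse us) [ u ] v ⟩
  μ* (reverse us) · ((μ u ⊗ I₂) · v)      ≡⟨ cong (μ* (reverse us) ·_) (·-⊗ (μ u) I₂ v) ⟩
  μ* (reverse us) · (μ u · (I₂ · v))      ≡⟨ cong (λ w → μ* (reverse us) · (μ u · w)) (·-I₂ v) ⟩
  μ* (reverse us) · (μ u · v) ∎
  where open ≡-Reasoning

Additive : (Col → ℤ) → Set
Additive f = ∀ v w → f (v +ᶜ w) ≡ f v ℤ.+ f w

firstRow-additive : ∀ M → Additive (λ v → proj₁ (M · v))
firstRow-additive M v w = cong proj₁ (·-+ᶜ M v w)

V₁ V₂ V₃ : Col
V₁ = (+ 1 , + 1)
V₂ = (+ 2 , + 3)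
V₃ = (+ 3 , + 4)

record Represents (f : Col → ℤ) (c : SubwordCounts) : Set where
  field
    lf-value      : + lf c                   ≡ f V₁
    blocks-value  : + suc (blocks c)         ≡ f V₂
    blocks₀-value : + suc (suc (blocks₀ c))  ≡ f V₃
open Represents

Represents-cong : ∀ {f g c} → (∀ v → f v ≡ g v) → Represents f c → Represents g c
Represents-cong f≗g r = record
  { lf-value      = trans (lf-value r) (f≗g V₁)
  ; blocks-value  = trans (blocks-value r) (f≗g V₂)
  ; blocks₀-value = trans (blocks₀-value r) (f≗g V₃)
  }

+-value : ∀ f → Additive f → ∀ {m n} v w → + m ≡ f v → + n ≡ f w → + (m + n) ≡ f (v +ᶜ w)
+-value f f-add {m} {n} v w m≡fv n≡fw =
  trans (pos-+ m n) (trans (cong₂ ℤ._+_ m≡fv n≡fw) (sym (f-add v w)))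

-- μ(0) maps V₁, V₂, V₃ to V₁, V₃, V₃ + V₁, and μ(01) maps them to V₂, 2V₂, 3V₂.
represents-z : ∀ {f} t → Additive f → Represents f (subwordCounts t) →
  Represents (λ v → f (μ z · v)) (subwordCounts (b0 ∷ t))
represents-z {f} t f-add r = record
  { lf-value      = lf-value r
  ; blocks-value  = blocks₀-value r
  ; blocks₀-value = +-value f f-add V₃ V₁ (blocks₀-value r) (lf-value r)
  }

represents-zo : ∀ {f} t → Additive f → Represents f (subwordCounts t) →
  Represents (λ v → f (μ zo · v)) (subwordCounts (b0 ∷ b1 ∷ t))
represents-zo {f} t f-add r = record
  { lf-value      = blocks-value r
  ; blocks-value  = trans (cong (λ k → + suc k) (sym (+-suc Y Y)))
                          (+-value f f-add V₂ V₂ (blocks-value r) (blocks-value r))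
  ; blocks₀-value = trans (cong +_ (thrice Y))
                          (+-value f f-add V₂ (V₂ +ᶜ V₂) (blocks-value r)
                            (+-value f f-add V₂ V₂ (blocks-value r) (blocks-value r)))
  }
  where
  Y : ℕ
  Y = blocks (subwordCounts t)
  thrice : ∀ y → suc (suc (y + y + suc y)) ≡ suc y + (suc y + suc y)
  thrice = ℕ-Solver.solve-∀

represents : ∀ us →
  Represents (λ v → proj₁ (μ* (reverse us) · v)) (subwordCounts (concatMap blockWord us))
represents []        = record { lf-value = refl ; blocks-value = refl ; blocks₀-value = refl }
represents (u ∷ us)  = Represents-cong (λ v → sym (cong proj₁ (μ*-reverse-∷-· u us v))) (step u)
  where
  f-add : Additive (λ v → proj₁ (μ* (reverse us) · v))
  f-add = firstRow-additive (μ* (reverse us))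
  step : ∀ u → Represents (λ v → proj₁ (μ* (reverse us) · (μ u · v)))
                          (subwordCounts (concatMap blockWord (u ∷ us)))
  step z  = represents-z  (concatMap blockWord us) f-add (represents us)
  step zo = represents-zo (concatMap blockWord us) f-add (represents us)

rowVec-first : ∀ M x y → rowVec (+ 1) (+ 0) M x y ≡ proj₁ (M · (x , y))
rowVec-first (mat a b c d) x y = row a b c d x y
  where
  row : ∀ a b c d x y → + 1 ℤ.* (a ℤ.* x ℤ.+ b ℤ.* y) ℤ.+ + 0 ℤ.* (c ℤ.* x ℤ.+ d ℤ.* y)
                  ≡ a ℤ.* x ℤ.+ b ℤ.* y
  row = solve-∀

corollary9p10 : (n : ℕ) (us : List Block) →
    concatMap blockWord us ≡ b0 ∷ repF n →
    + SF n ≡ rowVec (+ 1) (+ 0) (μ* (reverse us)) V0₁ V0₂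
-- The last step is definitional because S_F(0) evaluates to 1, i.e. (V0₁ , V0₂) is V₁.
corollary9p10 n us us≡0repF = begin
  + SF n                                          ≡⟨ cong +_ (SF≡lf n) ⟩
  + lf (subwordCounts (b0 ∷ repF n))              ≡⟨ cong (λ w → + lf (subwordCounts w)) (sym us≡0repF) ⟩
  + lf (subwordCounts (concatMap blockWord us))   ≡⟨ lf-value (represents us) ⟩
  proj₁ (μ* (reverse us) · V₁)                    ≡⟨ sym (rowVec-first (μ* (reverse us)) V0₁ V0₂) ⟩
  rowVec (+ 1) (+ 0) (μ* (reverse us)) V0₁ V0₂    ∎
  where open ≡-Reasoning
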